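{- Let $n \ge 1$ be an integer. If $f \in R$ satisfies $f \equiv 1 \pmod{\mu_n}$, then $f \in \mathcal{P}_n$.
   Context: $R := 1 + x\mathbb{Z}[[x]]$ is the set of formal power series with integer coefficients and constant term $1$. For an integer $n \ge 1$, $\mathcal{P}_n := \{ g^n \mid g \in R\}$, and $\mu_n := n \prod_{p \mid n} p$ (product over the primes dividing $n$). For power series $a, b$ with integer coefficients and an integer $m$, $a \equiv b \pmod{m}$ means every coefficient of $a-b$ is divisible by $m$. -}

module Defs where

open import Data.Nat as ℕ using (ℕ; zero; suc; _∸_)
open import Data.Nat.Divisibility using (_∣?_)
open import Data.Nat.Primality using (prime?)
open import Data.Integer as ℤ using (ℤ; +_; 1ℤ; 0ℤ)
open import Data.Integer.Divisibility using () renaming (_∣_ to _∣ℤ_)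
open import Relation.Nullary using (does)
open import Data.Bool using (if_then_else_; _∧_)
open import Relation.Binary.PropositionalEquality using (_≡_)

PowerSeries : Set
PowerSeries = ℕ → ℤ

sumTo : ℕ → (ℕ → ℤ) → ℤ
sumTo zero    f = f zero
sumTo (suc k) f = sumTo k f ℤ.+ f (suc k)

_⊛_ : PowerSeries → PowerSeries → PowerSeries
(a ⊛ b) k = sumTo k (λ i → a i ℤ.* b (k ∸ i))

one : PowerSeries
one zero    = 1ℤ
one (suc _) = 0ℤ

_^ˢ_ : PowerSeries → ℕ → PowerSeries
g ^ˢ zero  = one
g ^ˢ suc n = g ⊛ (g ^ˢ n)

-- membership in R = 1 + xℤ[[x]]
InR : PowerSeries → Set
InR f = f zero ≡ 1ℤ

InP : ℕ → PowerSeries → Set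
InP n f = Σ PowerSeries (λ g → InR g × (∀ k → (g ^ˢ n) k ≡ f k))
  where open import Data.Product using (Σ; _×_)

_≡ˢ_[mod_] : PowerSeries → PowerSeries → ℕ → Set
a ≡ˢ b [mod m ] = ∀ k → (+ m) ∣ℤ (a k ℤ.- b k)

primeProd : ℕ → ℕ → ℕ
primeProd n zero    = 1
primeProd n (suc N) =
  if does (prime? (suc N)) ∧ does (suc N ∣? n)
  then suc N ℕ.* primeProd n N
  else primeProd n N

-- product of the primes dividing n (for n ≥ 1 all such primes are ≤ n)
rad : ℕ → ℕ
rad n = primeProd n n

μ : ℕ → ℕ
μ n = n ℕ.* rad n

{-# OPTIONS --safe #-}
-- Write n = p₁ ⋯ p_r as a product of primes and extract the p_i-th roots one at a
-- time.  The key step is a Hensel lifting: if d ∣ M and f ≡ 1 (mod d M), then f = g^d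
-- with g ≡ 1 (mod M).  For G ≡ 1 (mod M) the binomial expansion gives
-- G^d ≡ 1 + d (G - 1) ≡ 1 (mod d M), because d M ∣ M².  So if G^d agrees with f up to
-- degree k, the next defect f_{k+1} - (G^d)_{k+1} is q d M for some q, and adding q M x^{k+1}
-- to G corrects it without disturbing lower degrees or the congruence G ≡ 1 (mod M).
-- Taking the root for p₁ out of f ≡ 1 (mod p₁ ⋯ p_r rad n) leaves a root that is
-- ≡ 1 (mod p₂ ⋯ p_r rad n), and every p_i still divides rad n, so induction on r works.
module Submission where

open import Defs
open import Data.Nat as ℕ using (ℕ; zero; suc; _∸_; _≤_; _<_; _≥_; z≤n; s≤s; NonZero)
open import Data.Nat.Properties as ℕ using (≤-refl; ≤-trans)
open import Data.Nat.Divisibility as ℕ using (_∣?_; ∣⇒≤) renaming (_∣_ to _∣ℕ_)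
open import Data.Nat.Primality using (Prime; prime?; ¬prime[0])
open import Data.Nat.Primality.Factorisation using (factorise; PrimeFactorisation)
open import Data.Nat.ListAction using (product)
open import Data.Nat.ListAction.Properties using (∈⇒∣product)
open import Data.Integer using (ℤ; +_; 0ℤ; 1ℤ; _+_; _*_; _-_)
open import Data.Integer.Properties
  using (+-assoc; +-identityˡ; +-identityʳ; +-inverseʳ; *-assoc; *-zeroˡ; *-zeroʳ;
         *-identityˡ; *-identityʳ; *-distribˡ-+; *-distribʳ-+; pos-*; +-commutativeSemigroup)
open import Data.Integer.Divisibility.Signed
  using (_∣_; divides; ∣ᵤ⇒∣; ∣-refl; ∣-trans; ∣m∣n⇒∣m+n; ∣m∣n⇒∣m-n; ∣n⇒∣m*n; *-monoʳ-∣; *-monoˡ-∣)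
open import Data.Integer.Tactic.RingSolver using (solve-∀)
open import Algebra.Properties.CommutativeSemigroup +-commutativeSemigroup using (interchange)
open import Data.List using (List; []; _∷_)
open import Data.List.Relation.Unary.All as All using (All; []; _∷_)
open import Data.Product using (Σ-syntax; _×_; _,_)
open import Data.Sum using (inj₁; inj₂)
open import Data.Bool using (true; false; _∧_)
open import Data.Empty using (⊥-elim)
open import Function using (_∘_)
open import Relation.Nullary using (does)
open import Relation.Nullary.Decidable using (dec-true)
open import Relation.Binary.PropositionalEquality
open ≡-Reasoning

sumTo-cong : ∀ k {f g : ℕ → ℤ} → (∀ i → i ≤ k → f i ≡ g i) → sumTo k f ≡ sumTo k g
sumTo-cong zero    f≡g = f≡g 0 z≤n
sumTo-cong (suc k) f≡g =
  cong₂ _+_ (sumTo-cong k (λ i i≤k → f≡g i (ℕ.m≤n⇒m≤1+n i≤k))) (f≡g (suc k) ≤-refl)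

sumTo-zero : ∀ k {f : ℕ → ℤ} → (∀ i → i ≤ k → f i ≡ 0ℤ) → sumTo k f ≡ 0ℤ
sumTo-zero zero    f≡0 = f≡0 0 z≤n
sumTo-zero (suc k) f≡0 =
  cong₂ _+_ (sumTo-zero k (λ i i≤k → f≡0 i (ℕ.m≤n⇒m≤1+n i≤k))) (f≡0 (suc k) ≤-refl)

sumTo-distrib-+ : ∀ k (f g : ℕ → ℤ) → sumTo k (λ i → f i + g i) ≡ sumTo k f + sumTo k g
sumTo-distrib-+ zero    f g = refl
sumTo-distrib-+ (suc k) f g = trans (cong (_+ (f (suc k) + g (suc k))) (sumTo-distrib-+ k f g))
                                    (interchange (sumTo k f) (sumTo k g) (f (suc k)) (g (suc k)))

sumTo-suc : ∀ k (f : ℕ → ℤ) → sumTo (suc k) f ≡ f 0 + sumTo k (f ∘ suc)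
sumTo-suc zero    f = refl
sumTo-suc (suc k) f = trans (cong (_+ f (suc (suc k))) (sumTo-suc k f)) (+-assoc (f 0) _ _)

*-distribˡ-sumTo : ∀ k c (f : ℕ → ℤ) → c * sumTo k f ≡ sumTo k (λ i → c * f i)
*-distribˡ-sumTo zero    c f = refl
*-distribˡ-sumTo (suc k) c f =
  trans (*-distribˡ-+ c (sumTo k f) (f (suc k))) (cong (_+ c * f (suc k)) (*-distribˡ-sumTo k c f))

*-distribʳ-sumTo : ∀ k c (f : ℕ → ℤ) → sumTo k f * c ≡ sumTo k (λ i → f i * c)
*-distribʳ-sumTo zero    c f = refl
*-distribʳ-sumTo (suc k) c f =
  trans (*-distribʳ-+ c (sumTo k f) (f (suc k))) (cong (_+ f (suc k) * c) (*-distribʳ-sumTo k c f))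

sumTo-triangle : ∀ k (F : ℕ → ℕ → ℤ) →
  sumTo k (λ m → sumTo m (λ i → F i m)) ≡ sumTo k (λ i → sumTo (k ∸ i) (λ j → F i (i ℕ.+ j)))
sumTo-triangle zero    F = refl
sumTo-triangle (suc k) F = begin
  sumTo k (λ m → sumTo m (λ i → F i m)) + (column + F (suc k) (suc k))
    ≡⟨ cong (_+ (column + F (suc k) (suc k))) (sumTo-triangle k F) ⟩
  sumTo k (row k) + (column + F (suc k) (suc k))
    ≡⟨ sym (+-assoc (sumTo k (row k)) column _) ⟩
  (sumTo k (row k) + column) + F (suc k) (suc k)
    ≡⟨ cong₂ _+_ (sym extend-rows) last-row ⟩
  sumTo k (row (suc k)) + row (suc k) (suc k) ∎
  where
  row : ℕ → ℕ → ℤ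
  row n i = sumTo (n ∸ i) (λ j → F i (i ℕ.+ j))
  column : ℤ
  column = sumTo k (λ i → F i (suc k))
  extend-row : ∀ i → i ≤ k → row (suc k) i ≡ row k i + F i (suc k)
  extend-row i i≤k rewrite ℕ.+-∸-assoc 1 i≤k =
    cong (λ m → row k i + F i m) (trans (ℕ.+-suc i (k ∸ i)) (cong suc (ℕ.m+[n∸m]≡n i≤k)))
  extend-rows : sumTo k (row (suc k)) ≡ sumTo k (row k) + column
  extend-rows = trans (sumTo-cong k extend-row) (sumTo-distrib-+ k _ _)
  last-row : F (suc k) (suc k) ≡ row (suc k) (suc k)
  last-row rewrite ℕ.n∸n≡0 k | ℕ.+-identityʳ k = refl

∣-sumTo : ∀ k {d} {f : ℕ → ℤ} → (∀ i → i ≤ k → d ∣ f i) → d ∣ sumTo k f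
∣-sumTo zero    d∣f = d∣f 0 z≤n
∣-sumTo (suc k) d∣f = ∣m∣n⇒∣m+n (∣-sumTo k (λ i i≤k → d∣f i (ℕ.m≤n⇒m≤1+n i≤k))) (d∣f (suc k) ≤-refl)

infixl 6 _⊕_ _⊖_
infixr 7 _·ˢ_
infix 4 _≡[≤_]_ _∣ˢ_

_⊕_ : PowerSeries → PowerSeries → PowerSeries
(a ⊕ b) k = a k + b k

_⊖_ : PowerSeries → PowerSeries → PowerSeries
(a ⊖ b) k = a k - b k

_·ˢ_ : ℤ → PowerSeries → PowerSeries
(c ·ˢ a) k = c * a k

_≡[≤_]_ : PowerSeries → ℕ → PowerSeries → Set
a ≡[≤ k ] b = ∀ i → i ≤ k → a i ≡ b i

_∣ˢ_ : ℤ → PowerSeries → Set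
m ∣ˢ a = ∀ k → m ∣ a k

≡[≤]-extend : ∀ {a b k} → a ≡[≤ k ] b → a (suc k) ≡ b (suc k) → a ≡[≤ suc k ] b
≡[≤]-extend a≡b top i i≤1+k with ℕ.m≤n⇒m<n∨m≡n i≤1+k
... | inj₁ (s≤s i≤k) = a≡b i i≤k
... | inj₂ refl      = top

⊛-cong-≤ : ∀ {a a′ b b′ k} → a ≡[≤ k ] a′ → b ≡[≤ k ] b′ → a ⊛ b ≡[≤ k ] a′ ⊛ b′
⊛-cong-≤ a≡a′ b≡b′ i i≤k = sumTo-cong i (λ j j≤i →
  cong₂ _*_ (a≡a′ j (≤-trans j≤i i≤k)) (b≡b′ (i ∸ j) (≤-trans (ℕ.m∸n≤m i j) i≤k)))

⊛-cong : ∀ {a a′ b b′} → a ≗ a′ → b ≗ b′ → a ⊛ b ≗ a′ ⊛ b′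
⊛-cong a≗a′ b≗b′ k = ⊛-cong-≤ (λ i _ → a≗a′ i) (λ i _ → b≗b′ i) k ≤-refl

⊛-congˡ : ∀ a {b b′} → b ≗ b′ → a ⊛ b ≗ a ⊛ b′
⊛-congˡ a = ⊛-cong {a = a} (λ _ → refl)

⊛-congʳ : ∀ b {a a′} → a ≗ a′ → a ⊛ b ≗ a′ ⊛ b
⊛-congʳ b a≗a′ = ⊛-cong {b = b} a≗a′ (λ _ → refl)

⊛-identityˡ : ∀ a → one ⊛ a ≗ a
⊛-identityˡ a zero    = *-identityˡ (a 0)
⊛-identityˡ a (suc k) = begin
  sumTo (suc k) (λ i → one i * a (suc k ∸ i))             ≡⟨ sumTo-suc k _ ⟩
  1ℤ * a (suc k) + sumTo k (λ i → 0ℤ * a (k ∸ i))         ≡⟨ cong₂ _+_ (*-identityˡ (a (suc k)))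
                                                                      (sumTo-zero k (λ _ _ → refl)) ⟩
  a (suc k) + 0ℤ                                          ≡⟨ +-identityʳ _ ⟩
  a (suc k)                                               ∎

⊛-identityʳ : ∀ a → a ⊛ one ≗ a
⊛-identityʳ a zero    = *-identityʳ (a 0)
⊛-identityʳ a (suc k) = begin
  sumTo k (λ i → a i * one (suc k ∸ i)) + a (suc k) * one (k ∸ k)
    ≡⟨ cong₂ _+_ (sumTo-zero k (λ i i≤k → trans (cong (λ j → a i * one j) (ℕ.+-∸-assoc 1 i≤k))
                                                (*-zeroʳ (a i))))
                 (cong (λ j → a (suc k) * one j) (ℕ.n∸n≡0 k)) ⟩
  0ℤ + a (suc k) * 1ℤ
    ≡⟨ trans (+-identityˡ _) (*-identityʳ _) ⟩
  a (suc k) ∎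

⊛-distribˡ : ∀ a b c → a ⊛ (b ⊕ c) ≗ a ⊛ b ⊕ a ⊛ c
⊛-distribˡ a b c k =
  trans (sumTo-cong k (λ i _ → *-distribˡ-+ (a i) (b (k ∸ i)) (c (k ∸ i)))) (sumTo-distrib-+ k _ _)

⊛-distribʳ : ∀ a b c → (a ⊕ b) ⊛ c ≗ a ⊛ c ⊕ b ⊛ c
⊛-distribʳ a b c k =
  trans (sumTo-cong k (λ i _ → *-distribʳ-+ (c (k ∸ i)) (a i) (b i))) (sumTo-distrib-+ k _ _)

⊛-assoc : ∀ a b c → (a ⊛ b) ⊛ c ≗ a ⊛ (b ⊛ c)
⊛-assoc a b c k = begin
  sumTo k (λ m → sumTo m (λ i → a i * b (m ∸ i)) * c (k ∸ m))
    ≡⟨ sumTo-cong k (λ m _ → *-distribʳ-sumTo m (c (k ∸ m)) _) ⟩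
  sumTo k (λ m → sumTo m (λ i → a i * b (m ∸ i) * c (k ∸ m)))
    ≡⟨ sumTo-triangle k (λ i m → a i * b (m ∸ i) * c (k ∸ m)) ⟩
  sumTo k (λ i → sumTo (k ∸ i) (λ j → a i * b (i ℕ.+ j ∸ i) * c (k ∸ (i ℕ.+ j))))
    ≡⟨ sumTo-cong k (λ i _ → sumTo-cong (k ∸ i) (λ j _ → reindex i j)) ⟩
  sumTo k (λ i → sumTo (k ∸ i) (λ j → a i * (b j * c (k ∸ i ∸ j))))
    ≡⟨ sumTo-cong k (λ i _ → sym (*-distribˡ-sumTo (k ∸ i) (a i) _)) ⟩
  sumTo k (λ i → a i * sumTo (k ∸ i) (λ j → b j * c (k ∸ i ∸ j))) ∎
  where
  reindex : ∀ i j → a i * b (i ℕ.+ j ∸ i) * c (k ∸ (i ℕ.+ j)) ≡ a i * (b j * c (k ∸ i ∸ j))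
  reindex i j rewrite ℕ.m+n∸m≡n i j | ℕ.∸-+-assoc k i j = *-assoc (a i) (b j) _

⊛-perturbˡ : ∀ {a′ a b k α} → a′ ≡[≤ k ] a → a′ (suc k) ≡ a (suc k) + α →
             (a′ ⊛ b) (suc k) ≡ (a ⊛ b) (suc k) + α * b 0
⊛-perturbˡ {a′} {a} {b} {k} {α} a′≡a top = begin
  (a′ ⊛ b) (suc k)
    ≡⟨⟩
  sumTo k (λ i → a′ i * b (suc k ∸ i)) + a′ (suc k) * b (k ∸ k)
    ≡⟨ cong₂ _+_ (sumTo-cong k (λ i i≤k → cong (_* b (suc k ∸ i)) (a′≡a i i≤k)))
                 (cong (_* b (k ∸ k)) top) ⟩
  sumTo k (λ i → a i * b (suc k ∸ i)) + (a (suc k) + α) * b (k ∸ k)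
    ≡⟨ split (sumTo k (λ i → a i * b (suc k ∸ i))) (a (suc k)) α (b (k ∸ k)) ⟩
  (a ⊛ b) (suc k) + α * b (k ∸ k)
    ≡⟨ cong (λ j → (a ⊛ b) (suc k) + α * b j) (ℕ.n∸n≡0 k) ⟩
  (a ⊛ b) (suc k) + α * b 0 ∎
  where
  split : ∀ s x α y → s + (x + α) * y ≡ (s + x * y) + α * y
  split = solve-∀

⊛-perturbʳ : ∀ {a b′ b k β} → b′ ≡[≤ k ] b → b′ (suc k) ≡ b (suc k) + β →
             (a ⊛ b′) (suc k) ≡ (a ⊛ b) (suc k) + a 0 * β
⊛-perturbʳ {a} {b′} {b} {k} {β} b′≡b top = begin
  (a ⊛ b′) (suc k)
    ≡⟨ sumTo-suc k _ ⟩
  a 0 * b′ (suc k) + sumTo k (λ i → a (suc i) * b′ (k ∸ i))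
    ≡⟨ cong₂ (λ x y → a 0 * x + y) top
             (sumTo-cong k (λ i _ → cong (a (suc i) *_) (b′≡b (k ∸ i) (ℕ.m∸n≤m k i)))) ⟩
  a 0 * (b (suc k) + β) + sumTo k (λ i → a (suc i) * b (k ∸ i))
    ≡⟨ split (a 0) (b (suc k)) β _ ⟩
  (a 0 * b (suc k) + sumTo k (λ i → a (suc i) * b (k ∸ i))) + a 0 * β
    ≡⟨ cong (_+ a 0 * β) (sym (sumTo-suc k _)) ⟩
  (a ⊛ b) (suc k) + a 0 * β ∎
  where
  split : ∀ x y β s → x * (y + β) + s ≡ (x * y + s) + x * β
  split = solve-∀

⊛-⊖one : ∀ a b → a ⊛ b ⊖ one ≗ (a ⊖ one) ⊕ (b ⊖ one) ⊕ (a ⊖ one) ⊛ (b ⊖ one)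
⊛-⊖one a b k = begin
  (a ⊛ b) k - one k                              ≡⟨ cong (_- one k) (⊛-congˡ a (split b) k) ⟩
  (a ⊛ (one ⊕ Y)) k - one k                      ≡⟨ cong (_- one k) (⊛-distribˡ a one Y k) ⟩
  (a ⊛ one) k + (a ⊛ Y) k - one k                ≡⟨ cong₂ (λ x y → x + y - one k) (⊛-identityʳ a k)
                                                          (⊛-congʳ Y (split a) k) ⟩
  a k + ((one ⊕ X) ⊛ Y) k - one k                ≡⟨ cong (λ x → a k + x - one k) (⊛-distribʳ one X Y k) ⟩
  a k + ((one ⊛ Y) k + (X ⊛ Y) k) - one k        ≡⟨ cong (λ x → a k + (x + (X ⊛ Y) k) - one k)
                                                          (⊛-identityˡ Y k) ⟩
  a k + (Y k + (X ⊛ Y) k) - one k                ≡⟨ regroup (a k) (Y k) _ (one k) ⟩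
  (a k - one k) + Y k + (X ⊛ Y) k                ∎
  where
  X Y : PowerSeries
  X = a ⊖ one
  Y = b ⊖ one
  split : ∀ c → c ≗ one ⊕ (c ⊖ one)
  split c k = lemma (c k) (one k)
    where
    lemma : ∀ x o → x ≡ o + (x - o)
    lemma = solve-∀
  regroup : ∀ x y z o → x + (y + z) - o ≡ (x - o) + y + z
  regroup = solve-∀

∣ˢ-⊛ : ∀ {m n a b} → m ∣ˢ a → n ∣ˢ b → m * n ∣ˢ a ⊛ b
∣ˢ-⊛ {m} {n} {a} {b} m∣a n∣b k =
  ∣-sumTo k (λ i _ → ∣-trans (*-monoˡ-∣ n (m∣a i)) (*-monoʳ-∣ (a i) (n∣b (k ∸ i))))

∣ˢ-⊛ʳ : ∀ {n} a {b} → n ∣ˢ b → n ∣ˢ a ⊛ b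
∣ˢ-⊛ʳ a n∣b k = ∣-sumTo k (λ i _ → ∣n⇒∣m*n (a i) (n∣b _))

∣ˢ-⊖-self : ∀ m a → m ∣ˢ a ⊖ a
∣ˢ-⊖-self m a k = subst (m ∣_) (sym (+-inverseʳ (a k))) (divides 0ℤ refl)

⊛-≡1 : ∀ {M a b} → M ∣ˢ a ⊖ one → M ∣ˢ b ⊖ one → M ∣ˢ a ⊛ b ⊖ one
⊛-≡1 {M} {a} {b} a≡1 b≡1 k = subst (M ∣_) (sym (⊛-⊖one a b k))
  (∣m∣n⇒∣m+n (∣m∣n⇒∣m+n (a≡1 k) (b≡1 k)) (∣ˢ-⊛ʳ (a ⊖ one) b≡1 k))

^ˢ-cong-≤ : ∀ {a b k} → a ≡[≤ k ] b → ∀ n → a ^ˢ n ≡[≤ k ] b ^ˢ n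
^ˢ-cong-≤ a≡b zero    i _ = refl
^ˢ-cong-≤ a≡b (suc n)     = ⊛-cong-≤ a≡b (^ˢ-cong-≤ a≡b n)

^ˢ-cong : ∀ {a b} → a ≗ b → ∀ n → a ^ˢ n ≗ b ^ˢ n
^ˢ-cong a≗b n k = ^ˢ-cong-≤ (λ i _ → a≗b i) n k ≤-refl

^ˢ-+ : ∀ h m n → h ^ˢ (m ℕ.+ n) ≗ (h ^ˢ m) ⊛ (h ^ˢ n)
^ˢ-+ h zero    n k = sym (⊛-identityˡ (h ^ˢ n) k)
^ˢ-+ h (suc m) n k = trans (⊛-congˡ h (^ˢ-+ h m n) k) (sym (⊛-assoc h (h ^ˢ m) (h ^ˢ n) k))

^ˢ-* : ∀ h m n → h ^ˢ (m ℕ.* n) ≗ (h ^ˢ n) ^ˢ m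
^ˢ-* h zero    n k = refl
^ˢ-* h (suc m) n k = trans (^ˢ-+ h n (m ℕ.* n) k) (⊛-congˡ (h ^ˢ n) (^ˢ-* h m n) k)

^ˢ-InR : ∀ {a} → InR a → ∀ n → InR (a ^ˢ n)
^ˢ-InR a₀ zero    = refl
^ˢ-InR a₀ (suc n) = cong₂ _*_ a₀ (^ˢ-InR a₀ n)

^ˢ-perturb : ∀ {G G′ k c} → InR G → G′ ≡[≤ k ] G → G′ (suc k) ≡ G (suc k) + c →
             ∀ d → (G′ ^ˢ d) (suc k) ≡ (G ^ˢ d) (suc k) + + d * c
^ˢ-perturb {c = c} G₀ G′≡G top zero = sym (trans (+-identityˡ (0ℤ * c)) (*-zeroˡ c))
^ˢ-perturb {G} {G′} {k} {c} G₀ G′≡G top (suc d) = begin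
  (G′ ⊛ (G′ ^ˢ d)) (suc k)
    ≡⟨ ⊛-perturbˡ {b = G′ ^ˢ d} G′≡G top ⟩
  (G ⊛ (G′ ^ˢ d)) (suc k) + c * (G′ ^ˢ d) 0
    ≡⟨ cong₂ _+_ (⊛-perturbʳ {a = G} (^ˢ-cong-≤ G′≡G d) (^ˢ-perturb G₀ G′≡G top d))
                 (cong (c *_) (^ˢ-InR (trans (G′≡G 0 z≤n) G₀) d)) ⟩
  (G ⊛ (G ^ˢ d)) (suc k) + G 0 * (+ d * c) + c * 1ℤ
    ≡⟨ cong (λ x → (G ⊛ (G ^ˢ d)) (suc k) + x * (+ d * c) + c * 1ℤ) G₀ ⟩
  (G ⊛ (G ^ˢ d)) (suc k) + 1ℤ * (+ d * c) + c * 1ℤ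
    ≡⟨ collect ((G ⊛ (G ^ˢ d)) (suc k)) (+ d) c ⟩
  (G ⊛ (G ^ˢ d)) (suc k) + (1ℤ + + d) * c ∎
  where
  collect : ∀ s D c → s + 1ℤ * (D * c) + c * 1ℤ ≡ s + (1ℤ + D) * c
  collect = solve-∀

^ˢ-≡1 : ∀ {M G} → M ∣ˢ G ⊖ one → ∀ j → M ∣ˢ G ^ˢ j ⊖ one
^ˢ-≡1 {M} G≡1 zero    = ∣ˢ-⊖-self M one
^ˢ-≡1 {G = G} G≡1 (suc j) = ⊛-≡1 {a = G} {b = G ^ˢ j} G≡1 (^ˢ-≡1 G≡1 j)

^ˢ-binomial : ∀ {M G} → M ∣ˢ G ⊖ one → ∀ j → M * M ∣ˢ (G ^ˢ j ⊖ one) ⊖ + j ·ˢ (G ⊖ one)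
^ˢ-binomial {M} {G} G≡1 zero    k = subst (M * M ∣_) (sym (vanish (one k) ((G ⊖ one) k))) (divides 0ℤ refl)
  where
  vanish : ∀ o e → o - o - 0ℤ * e ≡ 0ℤ
  vanish = solve-∀
^ˢ-binomial {M} {G} G≡1 (suc j) k = subst (M * M ∣_) (sym expand)
  (∣m∣n⇒∣m+n (^ˢ-binomial G≡1 j k) (∣ˢ-⊛ {a = E} {b = X} G≡1 (^ˢ-≡1 {G = G} G≡1 j) k))
  where
  E X : PowerSeries
  E = G ⊖ one
  X = G ^ˢ j ⊖ one
  regroup : ∀ e x p J → e + x + p - (1ℤ + J) * e ≡ (x - J * e) + p
  regroup = solve-∀
  expand : ((G ^ˢ suc j ⊖ one) ⊖ + suc j ·ˢ E) k ≡ (X ⊖ + j ·ˢ E) k + (E ⊛ X) k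
  expand = trans (cong (_- + suc j * E k) (⊛-⊖one G (G ^ˢ j) k)) (regroup (E k) (X k) ((E ⊛ X) k) (+ j))

^ˢ-lift : ∀ {d M G} → + d ∣ M → M ∣ˢ G ⊖ one → + d * M ∣ˢ G ^ˢ d ⊖ one
^ˢ-lift {d} {M} {G} d∣M G≡1 k = subst (+ d * M ∣_) (recombine ((G ^ˢ d ⊖ one) k) (+ d) ((G ⊖ one) k))
  (∣m∣n⇒∣m+n (*-monoʳ-∣ (+ d) (G≡1 k)) (∣-trans (*-monoˡ-∣ M d∣M) (^ˢ-binomial G≡1 d k)))
  where
  recombine : ∀ x D e → D * e + (x - D * e) ≡ x
  recombine = solve-∀

monomial : ℕ → ℤ → PowerSeries
monomial zero    c zero    = c
monomial zero    c (suc _) = 0ℤ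
monomial (suc _) c zero    = 0ℤ
monomial (suc j) c (suc i) = monomial j c i

monomial-diag : ∀ j c → monomial j c j ≡ c
monomial-diag zero    c = refl
monomial-diag (suc j) c = monomial-diag j c

monomial-< : ∀ {i j} c → i < j → monomial j c i ≡ 0ℤ
monomial-< {zero}  {suc j} c _         = refl
monomial-< {suc i} {suc j} c (s≤s i<j) = monomial-< c i<j

monomial-∣ : ∀ {m c} → m ∣ c → ∀ j → m ∣ˢ monomial j c
monomial-∣ m∣c zero    zero    = m∣c
monomial-∣ m∣c zero    (suc i) = divides 0ℤ refl
monomial-∣ m∣c (suc j) zero    = divides 0ℤ refl
monomial-∣ m∣c (suc j) (suc i) = monomial-∣ m∣c j i

⊕monomial-agrees : ∀ G k c → G ⊕ monomial (suc k) c ≡[≤ k ] G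
⊕monomial-agrees G k c i i≤k = trans (cong (λ x → G i + x) (monomial-< c (s≤s i≤k))) (+-identityʳ (G i))

module HenselLifting {d : ℕ} {M : ℤ} (d∣M : + d ∣ M)
                     {f : PowerSeries} (f₀ : InR f) (f≡1 : + d * M ∣ˢ f ⊖ one) where

  record RootUpTo (k : ℕ) : Set where
    field
      series     : PowerSeries
      series₀    : InR series
      series≡1   : M ∣ˢ series ⊖ one
      series^d≡f : series ^ˢ d ≡[≤ k ] f

  open RootUpTo

  module Refine {k} (r : RootUpTo k) where
    G : PowerSeries
    G = series r

    defect : + d * M ∣ f (suc k) - (G ^ˢ d) (suc k)
    defect = subst (+ d * M ∣_) (cancel (f (suc k)) ((G ^ˢ d) (suc k)) (one (suc k)))
                   (∣m∣n⇒∣m-n (f≡1 (suc k)) (^ˢ-lift d∣M (series≡1 r) (suc k)))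
      where
      cancel : ∀ x y o → (x - o) - (y - o) ≡ x - y
      cancel = solve-∀

    q : ℤ
    q = _∣_.quotient defect

    G′ : PowerSeries
    G′ = G ⊕ monomial (suc k) (q * M)

    G′≡G : G′ ≡[≤ k ] G
    G′≡G = ⊕monomial-agrees G k (q * M)

    G′^d-top : (G′ ^ˢ d) (suc k) ≡ f (suc k)
    G′^d-top = begin
      (G′ ^ˢ d) (suc k)          ≡⟨ ^ˢ-perturb (series₀ r) G′≡G G′-top d ⟩
      Gᵈ + + d * (q * M)         ≡⟨ cong (λ x → Gᵈ + x) (reassoc (+ d) q M) ⟩
      Gᵈ + q * (+ d * M)         ≡⟨ cong (λ x → Gᵈ + x) (sym (_∣_.equality defect)) ⟩
      Gᵈ + (f (suc k) - Gᵈ)      ≡⟨ cancel Gᵈ (f (suc k)) ⟩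
      f (suc k)                  ∎
      where
      Gᵈ : ℤ
      Gᵈ = (G ^ˢ d) (suc k)
      G′-top : G′ (suc k) ≡ G (suc k) + q * M
      G′-top = cong (λ x → G (suc k) + x) (monomial-diag (suc k) (q * M))
      reassoc : ∀ D q M → D * (q * M) ≡ q * (D * M)
      reassoc = solve-∀
      cancel : ∀ x y → x + (y - x) ≡ y
      cancel = solve-∀

    refined : RootUpTo (suc k)
    refined = record
      { series     = G′
      ; series₀    = trans (G′≡G 0 z≤n) (series₀ r)
      ; series≡1   = λ i → subst (M ∣_) (regroup (G i) _ (one i))
                               (∣m∣n⇒∣m+n (series≡1 r i) (monomial-∣ (∣n⇒∣m*n q ∣-refl) (suc k) i))
      ; series^d≡f = ≡[≤]-extend (λ i i≤k → trans (^ˢ-cong-≤ G′≡G d i i≤k)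
                                                  (series^d≡f r i i≤k))
                                 G′^d-top
      }
      where
      regroup : ∀ x m o → (x - o) + m ≡ (x + m) - o
      regroup = solve-∀

  approx : ∀ k → RootUpTo k
  approx zero    = record
    { series     = one
    ; series₀    = refl
    ; series≡1   = ∣ˢ-⊖-self M one
    ; series^d≡f = λ { zero z≤n → trans (^ˢ-InR {one} refl d) (sym f₀) }
    }
  approx (suc k) = Refine.refined (approx k)

  -- Refining past stage i never changes coefficient i again, so the diagonal is the limit.
  root : PowerSeries
  root i = series (approx i) i

  root≡1 : M ∣ˢ root ⊖ one
  root≡1 k = series≡1 (approx k) k

  approx-agrees : ∀ k → series (approx k) ≡[≤ k ] root
  approx-agrees zero    zero z≤n = refl
  approx-agrees (suc k)          = ≡[≤]-extend
    (λ i i≤k → trans (Refine.G′≡G (approx k) i i≤k) (approx-agrees k i i≤k)) refl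

  root^d≗f : root ^ˢ d ≗ f
  root^d≗f k = trans (^ˢ-cong-≤ (λ i i≤k → sym (approx-agrees k i i≤k)) d k ≤-refl)
                     (series^d≡f (approx k) k ≤-refl)

hensel-root : ∀ {d M f} → + d ∣ M → InR f → + d * M ∣ˢ f ⊖ one →
              Σ[ g ∈ PowerSeries ] InR g × M ∣ˢ g ⊖ one × g ^ˢ d ≗ f
hensel-root {f = f} d∣M f₀ f≡1 = root , refl , root≡1 , root^d≗f
  where open HenselLifting d∣M {f} f₀ f≡1

root-of-product : ∀ (ps : List ℕ) {M f} → All (_∣ℕ M) ps → InR f →
                  + (product ps ℕ.* M) ∣ˢ f ⊖ one → InP (product ps) f
root-of-product [] {f = f} _ f₀ _ = f , f₀ , ⊛-identityʳ f
root-of-product (p ∷ ps) {M} (p∣M ∷ ps∣M) f₀ f≡1 =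
  let g , g₀ , g≡1 , g^p≗f = hensel-root p∣m*M f₀ (subst (_∣ˢ _) reassociate f≡1)
      h , h₀ , h^m≗g       = root-of-product ps ps∣M g₀ g≡1
  in h , h₀ , λ k → trans (^ˢ-* h p (product ps) k) (trans (^ˢ-cong h^m≗g p k) (g^p≗f k))
  where
  p∣m*M : + p ∣ + (product ps ℕ.* M)
  p∣m*M = ∣ᵤ⇒∣ (ℕ.∣n⇒∣m*n (product ps) p∣M)
  reassociate : + (p ℕ.* product ps ℕ.* M) ≡ + p * + (product ps ℕ.* M)
  reassociate = trans (cong +_ (ℕ.*-assoc p (product ps) M)) (pos-* p (product ps ℕ.* M))

prime∣⇒∣primeProd : ∀ {p n N} → Prime p → p ∣ℕ n → p ≤ N → p ∣ℕ primeProd n N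
prime∣⇒∣primeProd {zero}          p-prime = ⊥-elim (¬prime[0] p-prime)
prime∣⇒∣primeProd {suc p} {n} {suc N} p-prime p∣n p≤N with ℕ.m≤n⇒m<n∨m≡n p≤N
... | inj₂ refl rewrite dec-true (prime? (suc p)) p-prime | dec-true (suc p ∣? n) p∣n = ℕ.m∣m*n _
... | inj₁ (s≤s p≤N′) with does (prime? (suc N)) ∧ does (suc N ∣? n)
...   | true  = ℕ.∣n⇒∣m*n (suc N) (prime∣⇒∣primeProd p-prime p∣n p≤N′)
...   | false = prime∣⇒∣primeProd p-prime p∣n p≤N′

prime∣⇒∣rad : ∀ {p n} .{{_ : NonZero n}} → Prime p → p ∣ℕ n → p ∣ℕ rad n
prime∣⇒∣rad p-prime p∣n = prime∣⇒∣primeProd p-prime p∣n (∣⇒≤ p∣n)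

corollary2 : (n : ℕ) → n ≥ 1 → (f : PowerSeries) → InR f →
  f ≡ˢ one [mod μ n ] → InP n f
corollary2 n@(suc _) _ f f₀ f≡1 =
  subst (λ m → InP m f) (sym n≡∏ps) (root-of-product ps ps∣rad f₀ f≡1′)
  where
  open PrimeFactorisation (factorise n) renaming (factors to ps; isFactorisation to n≡∏ps)
  ps∣rad : All (_∣ℕ rad n) ps
  ps∣rad = All.tabulate λ p∈ps →
    prime∣⇒∣rad (All.lookup factorsPrime p∈ps) (ℕ.∣-trans (∈⇒∣product p∈ps) (ℕ.∣-reflexive (sym n≡∏ps)))
  f≡1′ : + (product ps ℕ.* rad n) ∣ˢ f ⊖ one
  f≡1′ = subst (λ m → + (m ℕ.* rad n) ∣ˢ f ⊖ one) n≡∏ps (λ k → ∣ᵤ⇒∣ (f≡1 k))
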